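{- For every natural number $m$, there exists a set $A$ of positive integers such that the graph $G_\phi(A)$ has size $m$ (i.e. exactly $m$ edges).
   Context: $\phi$ denotes Euler's totient function, $\phi^0(n)=n$ and $\phi^i(n)=\phi(\phi^{i-1}(n))$. For a set $A$ of positive integers, $A_\phi=\{\phi^k(n): n\in A,\ k\ge 0\}$, and $G_\phi(A)$ is the simple graph with vertex set $A_\phi$ in which distinct vertices $r,s$ are adjacent iff $\phi(r)=s$ or $\phi(s)=r$. The size of a graph is its number of edges. -}

module Defs where

open import Level using (0ℓ)
open import Data.Nat using (ℕ; zero; suc; _<_)
open import Data.Nat.Coprimality using (Coprime; coprime?)
open import Data.List using (List; length; filter; map; upTo)
open import Data.List.Membership.Propositional using (_∈_)
open import Data.List.Relation.Unary.Unique.Propositional using (Unique)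
open import Data.Product using (_×_; ∃; Σ; _,_)
open import Data.Sum using (_⊎_)
open import Relation.Binary.PropositionalEquality using (_≡_)
open import Relation.Unary using (Pred)
open import Function.Bundles using (_⇔_)

φ : ℕ → ℕ
φ n = length (filter (λ k → coprime? k n) (map suc (upTo n)))

φ^ : ℕ → ℕ → ℕ
φ^ zero    n = n
φ^ (suc i) n = φ (φ^ i n)

Positive : Pred ℕ 0ℓ → Set
Positive A = ∀ n → A n → 0 < n

Aφ : Pred ℕ 0ℓ → Pred ℕ 0ℓ
Aφ A r = ∃ λ n → A n × ∃ λ k → φ^ k n ≡ r

-- adjacency in G_φ(A) of distinct vertices r < s (each unordered edge {r,s}
-- is represented once, as the pair (r , s) with r < s)
Edge : Pred ℕ 0ℓ → ℕ → ℕ → Set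
Edge A r s = r < s × Aφ A r × Aφ A s × (φ r ≡ s ⊎ φ s ≡ r)

-- G_φ(A) has size m: its edge set is finite with exactly m elements, i.e.
-- enumerated without repetition by a list of length m
HasSize : Pred ℕ 0ℓ → ℕ → Set
HasSize A m = Σ (List (ℕ × ℕ)) λ L →
  Unique L × (∀ r s → ((r , s) ∈ L) ⇔ Edge A r s) × length L ≡ m

-- Take A = {1, 2, 4, …, 2^m}. Among 1, …, 2^(j+1) exactly the odd numbers are coprime
-- to 2^(j+1), so φ(2^(j+1)) = 2^j. Hence A is closed under φ, A_φ = A, and the only
-- edges of G_φ(A) are {2^i, 2^(i+1)} for i < m: the graph is a path with m edges.
module Submission where

open import Defs
open import Level using (Level; 0ℓ)
open import Data.Nat
open import Data.Nat.Properties
open import Data.Nat.Divisibility using (∣-trans; n∣m*n; m∣m*n)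
open import Data.Nat.Coprimality using (Coprime; coprime?; coprime-divisor; coprime-+; 1-coprimeTo)
  renaming (sym to coprime-sym)
open import Data.List using (List; [_]; length; filter; map; upTo; _++_)
open import Data.List.Properties
  using (length-++; filter-++; filter-accept; filter-reject; map-++; upTo-∷ʳ; length-filter; length-map; length-upTo)
open import Data.List.Membership.Propositional using (_∈_)
open import Data.List.Membership.Propositional.Properties using (∈-map⁺; ∈-map⁻; ∈-upTo⁺; ∈-upTo⁻)
open import Data.List.Relation.Unary.Unique.Propositional using (Unique)
open import Data.List.Relation.Unary.Unique.Propositional.Properties using (upTo⁺)
  renaming (map⁺ to unique-map⁺)
open import Data.Product using (_×_; _,_; ∃; proj₁)
open import Data.Sum using (inj₁; inj₂)
open import Data.Empty using (⊥-elim)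
open import Function.Bundles using (_⇔_; mk⇔)
open import Relation.Binary.Definitions using (tri<; tri≈; tri>)
open import Relation.Binary.PropositionalEquality hiding ([_])
open import Relation.Nullary using (¬_)
open import Relation.Unary using (Pred; Decidable)

private
  variable
    ℓ : Level
    m n o : ℕ

^-injectiveʳ : ∀ b {i j} → 1 < b → b ^ i ≡ b ^ j → i ≡ j
^-injectiveʳ b {i} {j} 1<b eq with <-cmp i j
... | tri≈ _ i≡j _ = i≡j
... | tri< i<j _ _ = ⊥-elim (<-irrefl eq (^-monoʳ-< b 1<b i<j))
... | tri> _ _ j<i = ⊥-elim (<-irrefl (sym eq) (^-monoʳ-< b 1<b j<i))

coprime-* : Coprime m n → Coprime m o → Coprime m (n * o)
coprime-* {n = n} m⊥n m⊥o {d} (d∣m , d∣no) = m⊥o (d∣m , coprime-divisor d⊥n d∣no)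
  where
  d⊥n : Coprime d n
  d⊥n (e∣d , e∣n) = m⊥n (∣-trans e∣d d∣m , e∣n)

coprime-^ : Coprime m n → ∀ k → Coprime m (n ^ k)
coprime-^ {m} m⊥n zero    = coprime-sym (1-coprimeTo m)
coprime-^     m⊥n (suc k) = coprime-* m⊥n (coprime-^ m⊥n k)

odd-coprime-2 : ∀ k → Coprime (suc (k * 2)) 2
odd-coprime-2 zero    = 1-coprimeTo 2
odd-coprime-2 (suc k) = coprime-+ (odd-coprime-2 k)

even-¬coprime-2* : ∀ k n → ¬ Coprime (suc k * 2) (2 * n)
even-¬coprime-2* k n coprime with () ← coprime (n∣m*n (suc k) , m∣m*n n)

module _ {P : Pred ℕ ℓ} (P? : Decidable P) where

  countTo : ℕ → ℕ
  countTo n = length (filter P? (map suc (upTo n)))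

  countTo-≤ : ∀ n → countTo n ≤ n
  countTo-≤ n = begin
    countTo n                    ≤⟨ length-filter P? (map suc (upTo n)) ⟩
    length (map suc (upTo n))    ≡⟨ length-map suc (upTo n) ⟩
    length (upTo n)              ≡⟨ length-upTo n ⟩
    n                            ∎
    where open ≤-Reasoning

  countTo-suc : ∀ n → countTo (suc n) ≡ countTo n + length (filter P? [ suc n ])
  countTo-suc n = begin
    length (filter P? (map suc (upTo (suc n))))
      ≡⟨ cong (λ l → length (filter P? (map suc l))) (sym (upTo-∷ʳ n)) ⟩
    length (filter P? (map suc (upTo n ++ [ n ])))
      ≡⟨ cong (λ l → length (filter P? l)) (map-++ suc (upTo n) [ n ]) ⟩
    length (filter P? (map suc (upTo n) ++ [ suc n ]))
      ≡⟨ cong length (filter-++ P? (map suc (upTo n)) [ suc n ]) ⟩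
    length (filter P? (map suc (upTo n)) ++ filter P? [ suc n ])
      ≡⟨ length-++ (filter P? (map suc (upTo n))) ⟩
    countTo n + length (filter P? [ suc n ]) ∎
    where open ≡-Reasoning

  countTo-odd : (∀ k → P (suc (k * 2))) → (∀ k → ¬ P (suc k * 2)) → ∀ k → countTo (k * 2) ≡ k
  countTo-odd odd even zero    = refl
  countTo-odd odd even (suc k) = begin
    countTo (suc (suc (k * 2)))
      ≡⟨ countTo-suc (suc (k * 2)) ⟩
    countTo (suc (k * 2)) + length (filter P? [ suc k * 2 ])
      ≡⟨ cong₂ _+_ (countTo-suc (k * 2)) (cong length (filter-reject P? (even k))) ⟩
    countTo (k * 2) + length (filter P? [ suc (k * 2) ]) + 0
      ≡⟨ cong₂ (λ a b → a + b + 0) (countTo-odd odd even k) (cong length (filter-accept P? (odd k))) ⟩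
    k + 1 + 0
      ≡⟨ trans (+-identityʳ (k + 1)) (+-comm k 1) ⟩
    suc k ∎
    where open ≡-Reasoning

φ-≤ : ∀ n → φ n ≤ n
φ-≤ n = countTo-≤ (λ k → coprime? k n) n

φ-2^suc : ∀ j → φ (2 ^ suc j) ≡ 2 ^ j
φ-2^suc j = begin
  countTo P? (2 * 2 ^ j)   ≡⟨ cong (countTo P?) (*-comm 2 (2 ^ j)) ⟩
  countTo P? (2 ^ j * 2)   ≡⟨ countTo-odd P? odd even (2 ^ j) ⟩
  2 ^ j                    ∎
  where
  open ≡-Reasoning
  P? : Decidable (λ k → Coprime k (2 ^ suc j))
  P? k = coprime? k (2 ^ suc j)
  odd : ∀ k → Coprime (suc (k * 2)) (2 ^ suc j)
  odd k = coprime-^ (odd-coprime-2 k) (suc j)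
  even : ∀ k → ¬ Coprime (suc k * 2) (2 ^ suc j)
  even k = even-¬coprime-2* k (2 ^ j)

φ-2^ : ∀ j → φ (2 ^ j) ≡ 2 ^ pred j
φ-2^ zero    = refl
φ-2^ (suc j) = φ-2^suc j

φ^-closed : {A : Pred ℕ 0ℓ} → (∀ n → A n → A (φ n)) → ∀ k {n} → A n → A (φ^ k n)
φ^-closed closed zero    a = a
φ^-closed closed (suc k) a = closed _ (φ^-closed closed k a)

Aφ-closed : {A : Pred ℕ 0ℓ} → (∀ n → A n → A (φ n)) → ∀ {r} → Aφ A r → A r
Aφ-closed closed (n , a , k , refl) = φ^-closed closed k a

PowerOf2UpTo : ℕ → Pred ℕ 0ℓ
PowerOf2UpTo m n = ∃ λ j → j ≤ m × 2 ^ j ≡ n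

PowerOf2UpTo-φ : ∀ {m} n → PowerOf2UpTo m n → PowerOf2UpTo m (φ n)
PowerOf2UpTo-φ _ (j , j≤m , refl) = pred j , ≤-trans pred[n]≤n j≤m , sym (φ-2^ j)

powerOf2Edge : ℕ → ℕ × ℕ
powerOf2Edge i = 2 ^ i , 2 ^ suc i

powerOf2Edges : ℕ → List (ℕ × ℕ)
powerOf2Edges m = map powerOf2Edge (upTo m)

powerOf2Edge-injective : ∀ {i j} → powerOf2Edge i ≡ powerOf2Edge j → i ≡ j
powerOf2Edge-injective eq = ^-injectiveʳ 2 (s≤s (s≤s z≤n)) (cong proj₁ eq)

Edge-PowerOf2UpTo⇒∈ : ∀ m r s → Edge (PowerOf2UpTo m) r s → (r , s) ∈ powerOf2Edges m
Edge-PowerOf2UpTo⇒∈ m r s (r<s , _ , _ , inj₁ φr≡s) =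
  ⊥-elim (<-irrefl φr≡s (≤-<-trans (φ-≤ r) r<s))
Edge-PowerOf2UpTo⇒∈ m r s (r<s , ar , as , inj₂ φs≡r)
  with Aφ-closed PowerOf2UpTo-φ ar | Aφ-closed PowerOf2UpTo-φ as
... | i , _ , refl | zero , _ , refl = ⊥-elim (<-irrefl refl (<-≤-trans r<s (m^n>0 2 i)))
... | i , _ , refl | suc j , j<m , refl
  with refl ← ^-injectiveʳ 2 {j} {i} (s≤s (s≤s z≤n)) (trans (sym (φ-2^suc j)) φs≡r)
  = ∈-map⁺ powerOf2Edge (∈-upTo⁺ j<m)

∈⇒Edge-PowerOf2UpTo : ∀ m r s → (r , s) ∈ powerOf2Edges m → Edge (PowerOf2UpTo m) r s
∈⇒Edge-PowerOf2UpTo m r s rs∈ with i , i∈ , refl ← ∈-map⁻ powerOf2Edge rs∈ =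
  ^-monoʳ-< 2 (s≤s (s≤s z≤n)) (n<1+n i) , vertex i (<⇒≤ i<m) , vertex (suc i) i<m , inj₂ (φ-2^suc i)
  where
  i<m : i < m
  i<m = ∈-upTo⁻ i∈
  vertex : ∀ j → j ≤ m → Aφ (PowerOf2UpTo m) (2 ^ j)
  vertex j j≤m = 2 ^ j , (j , j≤m , refl) , 0 , refl

corollary2p5 : (m : ℕ) → ∃ λ (A : Pred ℕ 0ℓ) → Positive A × HasSize A m
corollary2p5 m = PowerOf2UpTo m , positive , powerOf2Edges m , unique , edges , size
  where
  positive : Positive (PowerOf2UpTo m)
  positive _ (j , _ , refl) = m^n>0 2 j
  unique : Unique (powerOf2Edges m)
  unique = unique-map⁺ powerOf2Edge-injective (upTo⁺ m)
  edges : ∀ r s → ((r , s) ∈ powerOf2Edges m) ⇔ Edge (PowerOf2UpTo m) r s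
  edges r s = mk⇔ (∈⇒Edge-PowerOf2UpTo m r s) (Edge-PowerOf2UpTo⇒∈ m r s)
  size : length (powerOf2Edges m) ≡ m
  size = trans (length-map powerOf2Edge (upTo m)) (length-upTo m)
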